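{- Let $G$ be a finite simple graph that is $K_{2,2,2}$-free and hole-edge-disjoint. Let $C$ be a hole of $G$ and let $e=uv$ be an edge of $C$. If $S_{C,e}^{(G)}\neq\emptyset$, then $X_{C,e}^{(G)}$ is a clique cut of $G$.
   Context: A hole is a chordless cycle of length at least $4$. $G$ is hole-edge-disjoint if its holes are pairwise edge-disjoint; $G$ is $K_{2,2,2}$-free if it has no induced subgraph isomorphic to the complete tripartite graph $K_{2,2,2}$. For a hole $C$, let $X_C^{(G)}=\{v\in V(G): uv\in E(G)\text{ for all }u\in V(C)\}$. A walk/path $W$ is $C$-avoiding if (1) none of its internal vertices lies in $V(C)\cup X_C^{(G)}$, and (2) if $W$ has length $1$, at least one of its two vertices is not in $V(C)\cup X_C^{(G)}$. For an edge $e=uv$ of $C$, let $\mathcal{P}_{C,uv}^{(G)}$ be the set of $C$-avoiding $(u,v)$-paths, $X_{C,e}^{(G)}=X_C^{(G)}\cup\{u,v\}$, and $S_{C,e}^{(G)}=\bigcup_{P\in\mathcal{P}_{C,uv}^{(G)}}V(P)\setminus\{u,v\}$. A set $X\subseteq V(G)$ is a clique cut if $G[X]$ is complete and $G-X$ has more connected components than $G$. -}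

module Defs where

open import Data.Nat using (ℕ; zero; suc; _≤_; _<_; _∸_)
open import Data.Fin using (Fin; toℕ; fromℕ)
open import Data.Bool using (Bool; T)
open import Data.Product using (Σ; ∃; _×_; _,_)
open import Data.Sum using (_⊎_)
open import Data.Unit using (⊤)
open import Relation.Nullary using (¬_)
open import Relation.Binary.PropositionalEquality using (_≡_; _≢_)
open import Function.Bundles using (_⇔_)
open import Function.Definitions using (Injective)

record Graph : Set where
  field
    n      : ℕ
    adj    : Fin n → Fin n → Bool
    sym    : ∀ x y → adj x y ≡ adj y x
    irrefl : ∀ x → ¬ T (adj x x)

module _ (G : Graph) where
  open Graph G

  V : Set
  V = Fin n

  Adj : V → V → Set
  Adj x y = T (adj x y)

  -- Holes: chordless cycles of length ≥ 4, given as an injective cyclic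
  -- sequence of vertices such that two cycle vertices are adjacent in G
  -- iff they are cyclically consecutive (cycle edges + no chords).

  CycNext : (len : ℕ) → Fin len → Fin len → Set
  CycNext len i j = (toℕ j ≡ suc (toℕ i)) ⊎ ((toℕ i ≡ len ∸ 1) × (toℕ j ≡ 0))

  CycAdj : (len : ℕ) → Fin len → Fin len → Set
  CycAdj len i j = CycNext len i j ⊎ CycNext len j i

  record Hole : Set where
    field
      len      : ℕ
      len≥4    : 4 ≤ len
      vert     : Fin len → V
      inj      : Injective _≡_ _≡_ vert
      chordless : ∀ i j → Adj (vert i) (vert j) ⇔ CycAdj len i j

  InHole : Hole → V → Set
  InHole C w = ∃ λ i → Hole.vert C i ≡ w

  EdgeOfHole : Hole → V → V → Set
  EdgeOfHole C x y =
    ∃ λ i → ∃ λ j → CycAdj (Hole.len C) i j × Hole.vert C i ≡ x × Hole.vert C j ≡ y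

  -- holes are pairwise edge-disjoint: two holes sharing an edge are the
  -- same hole (same vertex set; a chordless cycle is determined by it)
  HoleEdgeDisjoint : Set
  HoleEdgeDisjoint = ∀ (C D : Hole) (x y : V) →
    EdgeOfHole C x y → EdgeOfHole D x y → ∀ w → InHole C w ⇔ InHole D w

  part : Fin 6 → Fin 3
  part Fin.zero = Fin.zero
  part (Fin.suc Fin.zero) = Fin.zero
  part (Fin.suc (Fin.suc Fin.zero)) = Fin.suc Fin.zero
  part (Fin.suc (Fin.suc (Fin.suc Fin.zero))) = Fin.suc Fin.zero
  part (Fin.suc (Fin.suc (Fin.suc (Fin.suc Fin.zero)))) = Fin.suc (Fin.suc Fin.zero)
  part (Fin.suc (Fin.suc (Fin.suc (Fin.suc (Fin.suc Fin.zero))))) = Fin.suc (Fin.suc Fin.zero)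

  InducedK222 : (Fin 6 → V) → Set
  InducedK222 f = Injective _≡_ _≡_ f × (∀ i j → Adj (f i) (f j) ⇔ (part i ≢ part j))

  K222Free : Set
  K222Free = ∀ f → ¬ InducedK222 f

  X : Hole → V → Set
  X C w = ∀ u → InHole C u → Adj w u

  InCX : Hole → V → Set
  InCX C w = InHole C w ⊎ X C w

  record Path (x y : V) : Set where
    field
      len  : ℕ
      vert : Fin (suc len) → V
      inj  : Injective _≡_ _≡_ vert
      start : vert Fin.zero ≡ x
      end   : vert (fromℕ len) ≡ y
      step  : ∀ i j → toℕ j ≡ suc (toℕ i) → Adj (vert i) (vert j)

  Internal : ∀ {x y} → Path x y → V → Set
  Internal P w = ∃ λ i → (0 < toℕ i) × (toℕ i < Path.len P) × Path.vert P i ≡ w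

  CAvoiding : Hole → ∀ {x y} → Path x y → Set
  CAvoiding C {x} {y} P =
    (∀ w → Internal P w → ¬ InCX C w) ×
    (Path.len P ≡ 1 → ¬ InCX C x ⊎ ¬ InCX C y)

  XCe : Hole → V → V → V → Set
  XCe C x y w = X C w ⊎ w ≡ x ⊎ w ≡ y

  SCe : Hole → V → V → V → Set
  SCe C x y w = Σ (Path x y) λ P → CAvoiding C P × (∃ λ i → Path.vert P i ≡ w) × w ≢ x × w ≢ y

  data Conn (U : V → Set) : V → V → Set where
    here : ∀ {x} → Conn U x x
    step : ∀ {x z y} → U z → Adj x z → Conn U z y → Conn U x y

  -- G[U] has exactly k connected components: a surjective labelling of
  -- the vertices of U by Fin k whose fibres are exactly the components
  HasComponents : (U : V → Set) → ℕ → Set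
  HasComponents U k =
    Σ ((w : V) → U w → Fin k) λ f →
      (∀ c → ∃ λ w → Σ (U w) λ uw → f w uw ≡ c) ×
      (∀ x y (ux : U x) (uy : U y) → (f x ux ≡ f y uy) ⇔ Conn U x y)

  Whole : V → Set
  Whole _ = ⊤

  CliqueCut : (V → Set) → Set
  CliqueCut S =
    (∀ x y → S x → S y → x ≢ y → Adj x y) ×
    (∃ λ k → ∃ λ k' → HasComponents Whole k × HasComponents (λ w → ¬ S w) k' × k < k')

-- X_C is a clique: given non-adjacent x, y ∈ X_C and consecutive hole vertices c₀ c₁ c₂ c₃,
-- either C is a 4-hole and {x, y}, {c₀, c₂}, {c₁, c₃} induce K_{2,2,2}, or x c₀ y c₂ and
-- x c₀ y c₃ are two holes sharing the edge x c₀ but not the vertex c₂.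
--
-- For the cut, the key observation is that a connected set T outside C that joins a hole vertex
-- x to C − {x, w}, where w is a hole neighbour of x, yields (via a shortest path through T and
-- the rest of C) a second hole through the edge from x to its other hole neighbour, unless some
-- vertex of T sees both ends of that edge. Consequently no path outside C ∪ X_C joins neighbours
-- of two non-adjacent hole vertices. A vertex s ∈ S_{C,e} has such paths to a neighbour of u and
-- to a neighbour of v, so in G − X_{C,e} it reaches no vertex of C; in particular it is cut off
-- from the other hole neighbour c₀ of u, although s, c₀ and X_{C,e} lie in one component of G.

module Submission where

open import Defs
open import Data.Bool using (T)
open import Data.Empty using (⊥; ⊥-elim)
open import Data.Fin as F using (Fin; toℕ; fromℕ; fromℕ<)
open import Data.Fin.Patterns using (0F; 1F; 2F; 3F; 4F; 5F)
import Data.Fin.Properties as FinP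
open import Data.List using (List; []; _∷_; length; lookup; last)
open import Data.List.Membership.Propositional using (_∈_)
open import Data.List.Membership.Propositional.Properties using (∈-lookup)
open import Data.List.Relation.Unary.All as All using (All; []; _∷_)
import Data.List.Relation.Unary.Any as Any
open import Data.List.Relation.Unary.Any.Properties using (lookup-index)
open import Data.Maybe using (just)
open import Data.Maybe.Properties using (just-injective)
open import Data.Nat as ℕ using (ℕ; zero; suc; _+_; _∸_; _≤_; _<_; z≤n; s≤s)
open import Data.Nat.Properties
open import Data.Product using (Σ; ∃; _×_; _,_; proj₁; proj₂)
open import Data.Sum using (_⊎_; inj₁; inj₂; [_,_]′)
open import Data.Unit using (⊤; tt)
open import Function using (_∘_)
open import Function.Bundles using (_⇔_; mk⇔; Equivalence)
open import Relation.Binary.Definitions using (Decidable; DecidableEquality; tri<; tri≈; tri>)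
open import Relation.Binary.PropositionalEquality
open import Relation.Nullary using (¬_; Dec; yes; no)
open import Relation.Nullary.Decidable using (_×-dec_; _⊎-dec_; ¬?; T?)

-- Induced paths

lookup-last : ∀ {A : Set} x xs {y : A} → last (x ∷ xs) ≡ just y → lookup (x ∷ xs) (fromℕ (length xs)) ≡ y
lookup-last x []        refl = refl
lookup-last x (x′ ∷ xs) end  = lookup-last x′ xs end

module Shortcut {V : Set} (_≟_ : DecidableEquality V) {R : V → V → Set} (R? : Decidable R) where

  Far : V → V → Set
  Far a c = ¬ R a c × a ≢ c

  Induced : List V → Set
  Induced []          = ⊤
  Induced (a ∷ [])    = ⊤
  Induced (a ∷ b ∷ l) = R a b × a ≢ b × All (Far a) l × Induced (b ∷ l)

  Induced-tail : ∀ {a l} → Induced (a ∷ l) → Induced l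
  Induced-tail {l = []}    _                = tt
  Induced-tail {l = _ ∷ _} (_ , _ , _ , ind) = ind

  data Walk (P : V → Set) : V → V → Set where
    stop : ∀ {x} → Walk P x x
    move : ∀ {x z y} → R x z → P z → Walk P z y → Walk P x y

  _++ʷ_ : ∀ {P x y z} → Walk P x y → Walk P y z → Walk P x z
  stop         ++ʷ w′ = w′
  move r pz w ++ʷ w′ = move r pz (w ++ʷ w′)

  Near : V → V → Set
  Near x c = c ≡ x ⊎ R x c

  -- Prepending x to an induced path means cutting the path at its last vertex that is x or a
  -- neighbour of x.
  record Reentry (P : V → Set) (x y : V) : Set where
    field
      head      : V
      tail      : List V
      induced   : Induced (head ∷ tail)
      ends      : last (head ∷ tail) ≡ just y
      inside    : All P (head ∷ tail)
      head-near : head ≡ x ⊎ (R x head × head ≢ x)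
      tail-far  : All (λ c → ¬ Near x c) tail

  classify-head : ∀ {P y} x e r → Induced (e ∷ r) → last (e ∷ r) ≡ just y → All P (e ∷ r) →
                 All (λ c → ¬ Near x c) r → All (λ c → ¬ Near x c) (e ∷ r) ⊎ Reentry P x y
  classify-head x e r ind end inP far with e ≟ x | R? x e
  ... | yes e≡x | _ = inj₂ (record { head = e ; tail = r ; induced = ind ; ends = end ; inside = inP
                                   ; head-near = inj₁ e≡x ; tail-far = far })
  ... | no e≢x | yes xRe = inj₂ (record { head = e ; tail = r ; induced = ind ; ends = end ; inside = inP
                                        ; head-near = inj₂ (xRe , e≢x) ; tail-far = far })
  ... | no e≢x | no ¬xRe = inj₁ ([ e≢x , ¬xRe ]′ ∷ far)

  last-near : ∀ {P y} x e r → Induced (e ∷ r) → last (e ∷ r) ≡ just y → All P (e ∷ r) →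
             All (λ c → ¬ Near x c) (e ∷ r) ⊎ Reentry P x y
  last-near x e []      ind end inP = classify-head x e [] ind end inP []
  last-near x e (b ∷ r) ind end (pe ∷ inP) with last-near x b r (Induced-tail {e} ind) end inP
  ... | inj₂ re  = inj₂ re
  ... | inj₁ far = classify-head x e (b ∷ r) ind end (pe ∷ inP) far

  restart : ∀ {P x y} → Reentry P x y → Σ (List V) λ l → Induced (x ∷ l) × last (x ∷ l) ≡ just y × All P l
  restart record { tail = t ; induced = ind ; ends = end ; inside = _ ∷ inT ; head-near = inj₁ refl } =
    t , ind , end , inT
  restart {x = x} record { head = h ; tail = t ; induced = ind ; ends = end ; inside = inP
                         ; head-near = inj₂ (xRh , h≢x) ; tail-far = far } =
    h ∷ t , (xRh , ≢-sym h≢x , All.map far-of-not-near far , ind) , end , inP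
    where
    far-of-not-near : ∀ {c} → ¬ Near x c → Far x c
    far-of-not-near n = (λ r → n (inj₂ r)) , (λ e → n (inj₁ (sym e)))

  shortcut : ∀ {P x y} → Walk P x y → Σ (List V) λ l → Induced (x ∷ l) × last (x ∷ l) ≡ just y × All P l
  shortcut stop = [] , tt , refl , []
  shortcut {x = x} (move xRz pz w) with shortcut w
  ... | l , ind , end , inP with last-near x _ l ind end (pz ∷ inP)
  ...   | inj₁ (farZ ∷ _) = ⊥-elim (farZ (inj₂ xRz))
  ...   | inj₂ re         = restart re

  Induced-head : ∀ {a l} → Induced (a ∷ l) → All (a ≢_) l
  Induced-head {l = []}    _                = []
  Induced-head {l = _ ∷ _} (_ , a≢b , far , _) = a≢b ∷ All.map proj₂ far

  Induced-injective : ∀ l → Induced l → ∀ i j → lookup l i ≡ lookup l j → i ≡ j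
  Induced-injective (a ∷ l) ind F.zero    F.zero    eq = refl
  Induced-injective (a ∷ l) ind F.zero    (F.suc j) eq = ⊥-elim (All.lookup (Induced-head ind) (∈-lookup j) eq)
  Induced-injective (a ∷ l) ind (F.suc i) F.zero    eq = ⊥-elim (All.lookup (Induced-head ind) (∈-lookup i) (sym eq))
  Induced-injective (a ∷ l) ind (F.suc i) (F.suc j) eq =
    cong F.suc (Induced-injective l (Induced-tail {a} ind) i j eq)

  Induced-consecutive : ∀ l → Induced l → ∀ i j → toℕ j ≡ suc (toℕ i) → R (lookup l i) (lookup l j)
  Induced-consecutive (a ∷ b ∷ l) ind F.zero    (F.suc F.zero)    eq = proj₁ ind
  Induced-consecutive (a ∷ l)     ind (F.suc i) (F.suc j)         eq =
    Induced-consecutive l (Induced-tail {a} ind) i j (suc-injective eq)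

  Induced-related⇒consecutive : ∀ l → Induced l → ∀ i j → toℕ i < toℕ j → R (lookup l i) (lookup l j) →
                                toℕ j ≡ suc (toℕ i)
  Induced-related⇒consecutive (a ∷ b ∷ l) ind            F.zero    (F.suc F.zero)    i<j r = refl
  Induced-related⇒consecutive (a ∷ b ∷ l) (_ , _ , far , _) F.zero (F.suc (F.suc j)) i<j r =
    ⊥-elim (proj₁ (All.lookup far (∈-lookup j)) r)
  Induced-related⇒consecutive (a ∷ l)     ind (F.suc i) (F.suc j) (s≤s i<j) r =
    cong suc (Induced-related⇒consecutive l (Induced-tail {a} ind) i j i<j r)

-- The cyclic successor on Fin m

SuccMod : ℕ → ℕ → ℕ → Set
SuccMod m a b = b ≡ suc a ⊎ (a ≡ m ∸ 1 × b ≡ 0)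

next : ∀ {m} → Fin m → Fin m
next {suc m} i with suc (toℕ i) ℕ.<? suc m
... | yes i+1<m = fromℕ< i+1<m
... | no  _     = 0F

prev : ∀ {m} → Fin m → Fin m
prev {suc m} F.zero    = fromℕ m
prev {suc m} (F.suc i) = F.inject₁ i

next-SuccMod : ∀ {m} (i : Fin m) → SuccMod m (toℕ i) (toℕ (next i))
next-SuccMod {suc m} i with suc (toℕ i) ℕ.<? suc m
... | yes i+1<m = inj₁ (FinP.toℕ-fromℕ< i+1<m)
... | no  i+1≮m = inj₂ (≤-antisym (≤-pred (FinP.toℕ<n i)) (≤-pred (≮⇒≥ i+1≮m)) , refl)

prev-SuccMod : ∀ {m} (i : Fin m) → SuccMod m (toℕ (prev i)) (toℕ i)
prev-SuccMod {suc m} F.zero    = inj₂ (FinP.toℕ-fromℕ m , refl)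
prev-SuccMod {suc m} (F.suc i) = inj₁ (cong suc (sym (FinP.toℕ-inject₁ i)))

SuccMod-functional : ∀ {m a b b′} → b < m → b′ < m → SuccMod m a b → SuccMod m a b′ → b ≡ b′
SuccMod-functional _   _    (inj₁ b≡)       (inj₁ b′≡)       = trans b≡ (sym b′≡)
SuccMod-functional _   _    (inj₂ (_ , b≡)) (inj₂ (_ , b′≡)) = trans b≡ (sym b′≡)
SuccMod-functional {suc m} b<m _ (inj₁ refl) (inj₂ (refl , _)) = ⊥-elim (<-irrefl refl b<m)
SuccMod-functional {suc m} _ b′<m (inj₂ (refl , _)) (inj₁ refl) = ⊥-elim (<-irrefl refl b′<m)

SuccMod-injective : ∀ {m a a′ b} → SuccMod m a b → SuccMod m a′ b → a ≡ a′
SuccMod-injective (inj₁ b≡)       (inj₁ b≡′)       = suc-injective (trans (sym b≡) b≡′)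
SuccMod-injective (inj₂ (a≡ , _)) (inj₂ (a′≡ , _)) = trans a≡ (sym a′≡)
SuccMod-injective (inj₁ refl)     (inj₂ (_ , ()))
SuccMod-injective (inj₂ (_ , refl)) (inj₁ ())

SuccMod-irreflexive : ∀ {m a} → 2 ≤ m → ¬ SuccMod m a a
SuccMod-irreflexive _                 (inj₁ a≡1+a)       = <-irrefl a≡1+a ≤-refl
SuccMod-irreflexive (s≤s (s≤s _)) (inj₂ (() , refl))

SuccMod-asymmetric : ∀ {m a b} → 3 ≤ m → SuccMod m a b → ¬ SuccMod m b a
SuccMod-asymmetric _ (inj₁ refl) (inj₁ a≡) = m≢1+m+n _ {1} (trans a≡ (cong suc (+-comm 1 _)))
SuccMod-asymmetric (s≤s (s≤s (s≤s _))) (inj₁ refl)      (inj₂ (() , refl))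
SuccMod-asymmetric (s≤s (s≤s (s≤s _))) (inj₂ (refl , refl)) (inj₁ ())

SuccMod-no-triangle : ∀ {m a b c} → 4 ≤ m → SuccMod m a b → SuccMod m b c → ¬ SuccMod m c a
SuccMod-no-triangle _ (inj₁ refl) (inj₁ refl) (inj₁ a≡) = m≢1+m+n _ {2} (trans a≡ (cong suc (+-comm 2 _)))
SuccMod-no-triangle (s≤s (s≤s (s≤s (s≤s _)))) (inj₁ refl) (inj₁ refl) (inj₂ (() , refl))
SuccMod-no-triangle (s≤s (s≤s (s≤s (s≤s _)))) (inj₁ refl) (inj₂ (() , refl)) (inj₁ refl)
SuccMod-no-triangle (s≤s (s≤s (s≤s (s≤s _)))) (inj₂ (refl , refl)) (inj₁ refl) (inj₁ ())
SuccMod-no-triangle (s≤s (s≤s (s≤s (s≤s _)))) (inj₁ refl) (inj₂ (_ , refl)) (inj₂ (() , _))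
SuccMod-no-triangle (s≤s (s≤s (s≤s (s≤s _)))) (inj₂ (_ , refl)) (inj₁ refl) (inj₂ (() , _))
SuccMod-no-triangle (s≤s (s≤s (s≤s (s≤s _)))) (inj₂ (_ , refl)) (inj₂ (() , _)) _

next-injective : ∀ {m} {i j : Fin m} → next i ≡ next j → i ≡ j
next-injective {m} {i} {j} eq =
  FinP.toℕ-injective
    (SuccMod-injective {m} (next-SuccMod i) (subst (SuccMod m (toℕ j) ∘ toℕ) (sym eq) (next-SuccMod j)))

SuccMod⇒next : ∀ {m} (i j : Fin m) → SuccMod m (toℕ i) (toℕ j) → j ≡ next i
SuccMod⇒next i j i→j = FinP.toℕ-injective (SuccMod-functional (FinP.toℕ<n j) (FinP.toℕ<n _) i→j (next-SuccMod i))

next-prev : ∀ {m} (i : Fin m) → next (prev i) ≡ i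
next-prev i = sym (SuccMod⇒next (prev i) i (prev-SuccMod i))

next-toℕ : ∀ {m} (i : Fin m) → suc (toℕ i) < m → toℕ (next i) ≡ suc (toℕ i)
next-toℕ i 1+i<m with next-SuccMod i
... | inj₁ e        = e
... | inj₂ (i≡m-1 , _) =
  ⊥-elim (<-irrefl (trans (cong suc i≡m-1) (m+[n∸m]≡n {1} (≤-trans (s≤s z≤n) 1+i<m))) 1+i<m)

next-fromℕ : ∀ m → next (fromℕ m) ≡ 0F
next-fromℕ m = sym (SuccMod⇒next (fromℕ m) 0F (inj₂ (FinP.toℕ-fromℕ m , refl)))

next-reaches : ∀ {m} (Q : Fin m → Set) → (∀ i → Q i → Q (next i)) →
               ∀ d i j → toℕ j ≡ d + toℕ i → Q i → Q j
next-reaches Q Q-next zero    i j j≡i   Qi = subst Q (FinP.toℕ-injective (sym j≡i)) Qi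
next-reaches Q Q-next (suc d) i j j≡1+d+i Qi = next-reaches Q Q-next d (next i) j j≡d+next Qi′
  where
  1+i<m : suc (toℕ i) < _
  1+i<m = ≤-<-trans (≤-trans (s≤s (m≤n+m _ d)) (≤-reflexive (sym j≡1+d+i))) (FinP.toℕ<n j)
  j≡d+next : toℕ j ≡ d + toℕ (next i)
  j≡d+next = trans j≡1+d+i (sym (trans (cong (d +_) (next-toℕ i 1+i<m)) (+-suc d _)))
  Qi′ : Q (next i)
  Qi′ = Q-next i Qi

next-closed : ∀ {m} (Q : Fin m → Set) → (∀ i → Q i → Q (next i)) → ∀ i → Q i → ∀ j → Q j
next-closed {suc m} Q Q-next i Qi j with toℕ i ℕ.≤? toℕ j
... | yes i≤j = next-reaches Q Q-next (toℕ j ∸ toℕ i) i j (sym (m∸n+n≡m i≤j)) Qi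
... | no  _   = next-reaches Q Q-next (toℕ j) 0F j (sym (+-identityʳ _)) Q0
  where
  Qlast : Q (fromℕ m)
  Qlast = next-reaches Q Q-next (m ∸ toℕ i) i (fromℕ m)
            (trans (FinP.toℕ-fromℕ m) (sym (m∸n+n≡m (≤-pred (FinP.toℕ<n i))))) Qi
  Q0 : Q 0F
  Q0 = subst Q (next-fromℕ m) (Q-next (fromℕ m) Qlast)

-- Classes of a partial equivalence relation on Fin m

module _ {m : ℕ} (U : Fin m → Set) (R : Fin m → Fin m → Set) where

  Classes : ℕ → Set
  Classes k = Σ ((w : Fin m) → U w → Fin k) λ f →
    (∀ c → ∃ λ w → Σ (U w) λ uw → f w uw ≡ c) ×
    (∀ x y (ux : U x) (uy : U y) → (f x ux ≡ f y uy) ⇔ R x y)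

  record IsPartialEquivalenceOn : Set where
    field
      refl-on  : ∀ x → U x → R x x
      sym-on   : ∀ x y → U x → U y → R x y → R y x
      trans-on : ∀ x y z → U x → U y → U z → R x y → R y z → R x z

IsPartialEquivalenceOn-suc : ∀ {m U R} → IsPartialEquivalenceOn {suc m} U R →
                             IsPartialEquivalenceOn (U ∘ F.suc) (λ a b → R (F.suc a) (F.suc b))
IsPartialEquivalenceOn-suc eqv = record
  { refl-on  = λ a → refl-on (F.suc a)
  ; sym-on   = λ a b → sym-on (F.suc a) (F.suc b)
  ; trans-on = λ a b c → trans-on (F.suc a) (F.suc b) (F.suc c)
  }
  where open IsPartialEquivalenceOn eqv

-- Element 0 either lies outside U, joins the class of a later element, or gets a class of its own.
∃-classes : ∀ m (U : Fin m → Set) (R : Fin m → Fin m → Set) → (∀ x → Dec (U x)) → Decidable R →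
            IsPartialEquivalenceOn U R → ∃ (Classes U R)
∃-classes zero    U R U? R? eqv = 0 , (λ ()) , (λ ()) , (λ ())
∃-classes (suc m) U R U? R? eqv
  with ∃-classes m (U ∘ F.suc) (λ a b → R (F.suc a) (F.suc b)) (U? ∘ F.suc) (λ a b → R? (F.suc a) (F.suc b))
         (IsPartialEquivalenceOn-suc eqv)
... | k , f , onto , fibres with U? F.zero
...   | no ¬u0 = k , f′ , onto′ , fibres′
  where
  f′ : (w : Fin (suc m)) → U w → Fin k
  f′ F.zero    u = ⊥-elim (¬u0 u)
  f′ (F.suc i) u = f i u
  onto′ : ∀ c → ∃ λ w → Σ (U w) λ uw → f′ w uw ≡ c
  onto′ c with onto c
  ... | w , uw , e = F.suc w , uw , e
  fibres′ : ∀ x y (ux : U x) (uy : U y) → (f′ x ux ≡ f′ y uy) ⇔ R x y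
  fibres′ F.zero    _         u  _ = ⊥-elim (¬u0 u)
  fibres′ (F.suc _) F.zero    _  u = ⊥-elim (¬u0 u)
  fibres′ (F.suc a) (F.suc b) ua ub = fibres a b ua ub
...   | yes u0 with FinP.any? (λ i → U? (F.suc i) ×-dec R? F.zero (F.suc i))
...     | yes (i , ui , R0i) = k , f′ , onto′ , fibres′
  where
  open IsPartialEquivalenceOn eqv
  f′ : (w : Fin (suc m)) → U w → Fin k
  f′ F.zero    _ = f i ui
  f′ (F.suc j) u = f j u
  onto′ : ∀ c → ∃ λ w → Σ (U w) λ uw → f′ w uw ≡ c
  onto′ c with onto c
  ... | w , uw , e = F.suc w , uw , e
  Ri0 : R (F.suc i) F.zero
  Ri0 = sym-on F.zero (F.suc i) u0 ui R0i
  fibres′ : ∀ x y (ux : U x) (uy : U y) → (f′ x ux ≡ f′ y uy) ⇔ R x y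
  fibres′ F.zero    F.zero    u _ = mk⇔ (λ _ → refl-on F.zero u) (λ _ → refl)
  fibres′ F.zero    (F.suc b) u ub = mk⇔
    (λ e → trans-on F.zero (F.suc i) (F.suc b) u ui ub R0i (Equivalence.to (fibres i b ui ub) e))
    (λ r → Equivalence.from (fibres i b ui ub) (trans-on (F.suc i) F.zero (F.suc b) ui u ub Ri0 r))
  fibres′ (F.suc a) F.zero    ua u = mk⇔
    (λ e → trans-on (F.suc a) (F.suc i) F.zero ua ui u (Equivalence.to (fibres a i ua ui) e) Ri0)
    (λ r → Equivalence.from (fibres a i ua ui) (trans-on (F.suc a) F.zero (F.suc i) ua u ui r R0i))
  fibres′ (F.suc a) (F.suc b) ua ub = fibres a b ua ub
...     | no isolated = suc k , f′ , onto′ , fibres′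
  where
  open IsPartialEquivalenceOn eqv
  f′ : (w : Fin (suc m)) → U w → Fin (suc k)
  f′ F.zero    _ = F.zero
  f′ (F.suc j) u = F.suc (f j u)
  onto′ : ∀ c → ∃ λ w → Σ (U w) λ uw → f′ w uw ≡ c
  onto′ F.zero = F.zero , u0 , refl
  onto′ (F.suc c) with onto c
  ... | w , uw , e = F.suc w , uw , cong F.suc e
  fibres′ : ∀ x y (ux : U x) (uy : U y) → (f′ x ux ≡ f′ y uy) ⇔ R x y
  fibres′ F.zero    F.zero    u  _  = mk⇔ (λ _ → refl-on F.zero u) (λ _ → refl)
  fibres′ F.zero    (F.suc b) u  ub = mk⇔ (λ ()) (λ r → ⊥-elim (isolated (b , ub , r)))
  fibres′ (F.suc a) F.zero    ua u  = mk⇔ (λ ()) (λ r → ⊥-elim (isolated (a , ua , sym-on _ _ ua u r)))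
  fibres′ (F.suc a) (F.suc b) ua ub = mk⇔ (λ e → Equivalence.to (fibres a b ua ub) (FinP.suc-injective e))
                                          (λ r → cong F.suc (Equivalence.from (fibres a b ua ub) r))

module GraphFacts (G : Graph) where

  _~_ : V G → V G → Set
  _~_ = Adj G

  _≟ᵥ_ : DecidableEquality (V G)
  _≟ᵥ_ = FinP._≟_

  adj? : Decidable _~_
  adj? x y = T? (Graph.adj G x y)

  ~-sym : ∀ {x y} → x ~ y → y ~ x
  ~-sym {x} {y} = subst T (Graph.sym G x y)

  ~-irrefl : ∀ {x y} → x ~ y → x ≢ y
  ~-irrefl {x} x~x refl = Graph.irrefl G x x~x

  Conn-mono : ∀ {P Q : V G → Set} → (∀ w → P w → Q w) → ∀ {x y} → Conn G P x y → Conn G Q x y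
  Conn-mono P⊆Q here           = here
  Conn-mono P⊆Q (step pz xz c) = step (P⊆Q _ pz) xz (Conn-mono P⊆Q c)

  Conn-trans : ∀ {P x y z} → Conn G P x y → Conn G P y z → Conn G P x z
  Conn-trans here           d = d
  Conn-trans (step pz xz c) d = step pz xz (Conn-trans c d)

  Conn-snoc : ∀ {P x y z} → Conn G P x y → P z → y ~ z → Conn G P x z
  Conn-snoc c pz yz = Conn-trans c (step pz yz here)

  Conn-sym : ∀ {P x y} → P x → Conn G P x y → Conn G P y x
  Conn-sym px here           = here
  Conn-sym px (step pz xz c) = Conn-snoc (Conn-sym pz c) px (~-sym xz)

  Conn-target : ∀ {P x y} → P x → Conn G P x y → P y
  Conn-target px here          = px
  Conn-target px (step pz _ c) = Conn-target pz c

  AdjWithout : V G → V G → V G → V G → Set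
  AdjWithout p q a b = a ~ b × ¬ (a ≡ p × b ≡ q) × ¬ (a ≡ q × b ≡ p)

  adjWithout? : ∀ p q → Decidable (AdjWithout p q)
  adjWithout? p q a b = adj? a b ×-dec ¬? ((a ≟ᵥ p) ×-dec (b ≟ᵥ q)) ×-dec ¬? ((a ≟ᵥ q) ×-dec (b ≟ᵥ p))

  hole-from-induced-path : ∀ {p q} → p ~ q → ∀ l → Shortcut.Induced _≟ᵥ_ (adjWithout? p q) (q ∷ l) →
                 last (q ∷ l) ≡ just p → 4 ≤ length (q ∷ l) →
                 Σ (Hole G) λ D → EdgeOfHole G D p q × (∀ w → InHole G D w ⇔ w ∈ q ∷ l)
  hole-from-induced-path {p} {q} p~q l ind end 4≤L =
    D , (lastI , 0F , inj₁ (inj₂ (FinP.toℕ-fromℕ _ , refl)) , lk-last , refl)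
      , λ w → mk⇔ (λ { (k , refl) → ∈-lookup k }) (λ w∈ → Any.index w∈ , sym (lookup-index w∈))
    where
    open Shortcut _≟ᵥ_ (adjWithout? p q)
    L : ℕ
    L = length (q ∷ l)
    lk : Fin L → V G
    lk = lookup (q ∷ l)
    lastI : Fin L
    lastI = fromℕ (length l)
    lk-last : lk lastI ≡ p
    lk-last = lookup-last q l end
    inj : ∀ i j → lk i ≡ lk j → i ≡ j
    inj = Induced-injective (q ∷ l) ind
    forward : ∀ i j → toℕ i < toℕ j → lk i ~ lk j → CycAdj G L i j
    forward i j i<j ij with (lk i ≟ᵥ q) ×-dec (lk j ≟ᵥ p)
    ... | yes (iq , jp) = inj₂ (inj₂ (trans (cong toℕ (inj j lastI (trans jp (sym lk-last)))) (FinP.toℕ-fromℕ _)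
                                     , cong toℕ (inj i 0F iq)))
    ... | no ¬qp = inj₁ (inj₁ (Induced-related⇒consecutive (q ∷ l) ind i j i<j (ij , ¬pq , ¬qp)))
      where
      ¬pq : ¬ (lk i ≡ p × lk j ≡ q)
      ¬pq (_ , jq) = n≮0 (subst (toℕ i <_) (cong toℕ (inj j 0F jq)) i<j)
    to : ∀ i j → lk i ~ lk j → CycAdj G L i j
    to i j ij with <-cmp (toℕ i) (toℕ j)
    ... | tri< i<j _ _ = forward i j i<j ij
    ... | tri≈ _ i≡j _ = ⊥-elim (~-irrefl ij (cong lk (FinP.toℕ-injective i≡j)))
    ... | tri> _ _ j<i = [ inj₂ , inj₁ ]′ (forward j i j<i (~-sym ij))
    from : ∀ i j → CycNext G L i j → lk i ~ lk j
    from i j (inj₁ j≡1+i) = proj₁ (Induced-consecutive (q ∷ l) ind i j j≡1+i)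
    from i j (inj₂ (i≡last , j≡0)) =
      subst₂ _~_ (trans (sym lk-last) (cong lk (FinP.toℕ-injective (trans (FinP.toℕ-fromℕ _) (sym i≡last)))))
                 (sym (cong lk (FinP.toℕ-injective {i = j} {j = 0F} j≡0))) p~q
    D : Hole G
    D = record { len = L ; len≥4 = 4≤L ; vert = lk ; inj = λ {i} {j} → inj i j
               ; chordless = λ i j → mk⇔ (to i j) [ from i j , (λ ji → ~-sym (from j i ji)) ]′ }

  square-hole : ∀ {a b c d} → a ~ b → b ~ c → c ~ d → d ~ a → ¬ a ~ c → ¬ b ~ d → a ≢ c → b ≢ d →
                Σ (Hole G) λ D → EdgeOfHole G D a b × (∀ w → InHole G D w ⇔ w ∈ b ∷ c ∷ d ∷ a ∷ [])
  square-hole {a} {b} {c} {d} ab bc cd da a≁c b≁d a≢c b≢d =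
    hole-from-induced-path ab (c ∷ d ∷ a ∷ [])
      ( (bc , (λ z → ~-irrefl ab (sym (proj₁ z))) , (λ z → a≢c (sym (proj₂ z))))
      , ~-irrefl bc
      , ((λ z → b≁d (proj₁ z)) , b≢d) ∷ ((λ z → proj₂ (proj₂ z) (refl , refl)) , ~-irrefl (~-sym ab)) ∷ []
      , (cd , (λ z → b≢d (sym (proj₂ z))) , (λ z → ~-irrefl bc (sym (proj₁ z))))
      , ~-irrefl cd
      , ((λ z → a≁c (~-sym (proj₁ z))) , ≢-sym a≢c) ∷ []
      , (da , (λ z → ~-irrefl da (proj₁ z)) , (λ z → b≢d (sym (proj₁ z))))
      , ~-irrefl da , [] , tt)
      refl (s≤s (s≤s (s≤s (s≤s z≤n))))

  side : Fin 6 → Fin 2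
  side 0F = 0F
  side 1F = 1F
  side 2F = 0F
  side 3F = 1F
  side 4F = 0F
  side 5F = 1F

  cell : Fin 3 → Fin 2 → Fin 6
  cell 0F 0F = 0F
  cell 0F 1F = 1F
  cell 1F 0F = 2F
  cell 1F 1F = 3F
  cell 2F 0F = 4F
  cell 2F 1F = 5F

  cell-part-side : ∀ i → cell (part G i) (side i) ≡ i
  cell-part-side 0F = refl
  cell-part-side 1F = refl
  cell-part-side 2F = refl
  cell-part-side 3F = refl
  cell-part-side 4F = refl
  cell-part-side 5F = refl

  K222-induced : (v : Fin 3 → Fin 2 → V G) → (∀ p → v p 0F ≢ v p 1F) → (∀ p → ¬ v p 0F ~ v p 1F) →
                 (∀ s t → v 0F s ~ v 1F t) → (∀ s t → v 0F s ~ v 2F t) → (∀ s t → v 1F s ~ v 2F t) →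
                 InducedK222 G (λ i → v (part G i) (side i))
  K222-induced v distinct nonadjacent v01 v02 v12 = (λ {i} {j} → injective i j) , λ i j → mk⇔ (apart i j) (across i j)
    where
    cross : ∀ p q → p ≢ q → ∀ s t → v p s ~ v q t
    cross 0F 0F p≢q = ⊥-elim (p≢q refl)
    cross 0F 1F _   = v01
    cross 0F 2F _   = v02
    cross 1F 0F _   = λ s t → ~-sym (v01 t s)
    cross 1F 1F p≢q = ⊥-elim (p≢q refl)
    cross 1F 2F _   = v12
    cross 2F 0F _   = λ s t → ~-sym (v02 t s)
    cross 2F 1F _   = λ s t → ~-sym (v12 t s)
    cross 2F 2F p≢q = ⊥-elim (p≢q refl)
    within : ∀ p s t → ¬ v p s ~ v p t
    within p 0F 0F = λ a → ~-irrefl a refl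
    within p 0F 1F = nonadjacent p
    within p 1F 0F = λ a → nonadjacent p (~-sym a)
    within p 1F 1F = λ a → ~-irrefl a refl
    within-injective : ∀ p s t → v p s ≡ v p t → s ≡ t
    within-injective p 0F 0F _ = refl
    within-injective p 0F 1F e = ⊥-elim (distinct p e)
    within-injective p 1F 0F e = ⊥-elim (distinct p (sym e))
    within-injective p 1F 1F _ = refl
    apart : ∀ i j → v (part G i) (side i) ~ v (part G j) (side j) → part G i ≢ part G j
    apart i j a e rewrite e = within (part G j) (side i) (side j) a
    across : ∀ i j → part G i ≢ part G j → v (part G i) (side i) ~ v (part G j) (side j)
    across i j ne = cross (part G i) (part G j) ne (side i) (side j)
    injective : ∀ i j → v (part G i) (side i) ≡ v (part G j) (side j) → i ≡ j
    injective i j e with part G i FinP.≟ part G j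
    ... | no ne = ⊥-elim (~-irrefl (across i j ne) e)
    ... | yes pe = begin
      i                             ≡⟨ sym (cell-part-side i) ⟩
      cell (part G i) (side i)      ≡⟨ cong₂ cell pe (within-injective (part G j) (side i) (side j) e′) ⟩
      cell (part G j) (side j)      ≡⟨ cell-part-side j ⟩
      j                             ∎
      where
      open ≡-Reasoning
      e′ : v (part G j) (side i) ≡ v (part G j) (side j)
      e′ = subst (λ p → v p (side i) ≡ _) pe e

  module _ {U : V G → Set} (U? : ∀ v → Dec (U v)) where
    open Shortcut _≟ᵥ_ adj?

    ReachWithin : ℕ → V G → V G → Set
    ReachWithin zero    x y = x ≡ y
    ReachWithin (suc k) x y = x ≡ y ⊎ ∃ λ z → (U z × x ~ z) × ReachWithin k z y

    reachWithin? : ∀ k → Decidable (ReachWithin k)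
    reachWithin? zero    x y = x ≟ᵥ y
    reachWithin? (suc k) x y = (x ≟ᵥ y) ⊎-dec FinP.any? (λ z → (U? z ×-dec adj? x z) ×-dec reachWithin? k z y)

    ReachWithin⇒Conn : ∀ k {x y} → ReachWithin k x y → Conn G U x y
    ReachWithin⇒Conn zero    refl                      = here
    ReachWithin⇒Conn (suc k) (inj₁ refl)               = here
    ReachWithin⇒Conn (suc k) (inj₂ (z , (uz , xz) , r)) = step uz xz (ReachWithin⇒Conn k r)

    ReachWithin-mono : ∀ {k k′ x y} → k ≤ k′ → ReachWithin k x y → ReachWithin k′ x y
    ReachWithin-mono {zero}  {zero}   _         r = r
    ReachWithin-mono {zero}  {suc k′} _         r = inj₁ r
    ReachWithin-mono {suc k} {suc k′} _         (inj₁ e) = inj₁ e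
    ReachWithin-mono {suc k} {suc k′} (s≤s k≤k′) (inj₂ (z , zx , r)) = inj₂ (z , zx , ReachWithin-mono k≤k′ r)

    Induced⇒ReachWithin : ∀ x y l → Induced (x ∷ l) → last (x ∷ l) ≡ just y → All U l →
                          ReachWithin (length l) x y
    Induced⇒ReachWithin x y []      _               end _          = just-injective end
    Induced⇒ReachWithin x y (z ∷ l) (xz , _ , _ , ind) end (uz ∷ ul) =
      inj₂ (z , (uz , xz) , Induced⇒ReachWithin z y l ind end ul)

    Induced-length : ∀ l → Induced l → length l ≤ Graph.n G
    Induced-length l ind with length l ℕ.≤? Graph.n G
    ... | yes l≤n = l≤n
    ... | no  l≰n with FinP.pigeonhole (≰⇒> l≰n) (lookup l)
    ...   | i , j , i<j , eq = ⊥-elim (<-irrefl (cong toℕ (Induced-injective l ind i j eq)) i<j)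

    Conn⇒Walk : ∀ {x y} → Conn G U x y → Walk U x y
    Conn⇒Walk here           = stop
    Conn⇒Walk (step uz xz c) = move xz uz (Conn⇒Walk c)

    Conn⇒ReachWithin : ∀ {x y} → Conn G U x y → ReachWithin (Graph.n G) x y
    Conn⇒ReachWithin {x} {y} c with shortcut (Conn⇒Walk c)
    ... | l , ind , end , ul =
      ReachWithin-mono (≤-trans (n≤1+n _) (Induced-length (x ∷ l) ind)) (Induced⇒ReachWithin x y l ind end ul)

    conn? : Decidable (Conn G U)
    conn? x y with reachWithin? (Graph.n G) x y
    ... | yes r = yes (ReachWithin⇒Conn _ r)
    ... | no ¬r = no (λ c → ¬r (Conn⇒ReachWithin c))

    components : ∃ (HasComponents G U)
    components = ∃-classes (Graph.n G) U (Conn G U) U? conn?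
      (record { refl-on = λ _ _ → here ; sym-on = λ _ _ ux _ → Conn-sym ux ; trans-on = λ _ _ _ _ _ _ → Conn-trans })

  -- Every component of G survives in G − S, and the one containing c₀ and S splits.
  more-components : ∀ {S : V G → Set} {k k′ c₀ s} →
    HasComponents G (Whole G) k → HasComponents G (λ w → ¬ S w) k′ →
    ¬ S c₀ → (∀ w → S w → Conn G (Whole G) w c₀) →
    ¬ S s → Conn G (Whole G) s c₀ → ¬ Conn G (λ w → ¬ S w) s c₀ → k < k′
  more-components {S} {k} {k′} {c₀} {s} (f , onto , fibres) (g , _ , gfibres) ¬Sc₀ S⇝c₀ ¬Ss s⇝c₀ ¬s⇝c₀ =
    k<k′
    where
    label : V G → Fin k
    label w = f w tt
    label-conn : ∀ {a b} → Conn G (Whole G) a b → label a ≡ label b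
    label-conn {a} {b} = Equivalence.from (fibres a b tt tt)
    outside-conn : ∀ {a b} (¬Sa : ¬ S a) (¬Sb : ¬ S b) → g a ¬Sa ≡ g b ¬Sb → Conn G (Whole G) a b
    outside-conn {a} {b} ¬Sa ¬Sb e = Conn-mono (λ _ _ → tt) (Equivalence.to (gfibres a b ¬Sa ¬Sb) e)
    representative : (cl : Fin k) → Σ (V G) λ w → ¬ S w × label w ≡ cl × (cl ≡ label c₀ → w ≡ c₀)
    representative cl with cl FinP.≟ label c₀
    ... | yes cl≡ = c₀ , ¬Sc₀ , sym cl≡ , (λ _ → refl)
    ... | no cl≢ with onto cl
    ...   | w , _ , lw≡ =
      w , (λ Sw → cl≢ (trans (sym lw≡) (label-conn (S⇝c₀ w Sw)))) , lw≡ , (λ e → ⊥-elim (cl≢ e))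
    h : Fin (suc k) → Fin k′
    h 0F        = g s ¬Ss
    h (F.suc cl) = g (proj₁ (representative cl)) (proj₁ (proj₂ (representative cl)))
    s-apart : ∀ cl → h 0F ≢ h (F.suc cl)
    s-apart cl e with representative cl
    ... | w , ¬Sw , lw≡ , w≡c₀ =
      ¬s⇝c₀ (subst (Conn G (λ w → ¬ S w) s) (w≡c₀ cl≡) (Equivalence.to (gfibres s w ¬Ss ¬Sw) e))
      where
      cl≡ : cl ≡ label c₀
      cl≡ = trans (sym lw≡) (trans (sym (label-conn (outside-conn ¬Ss ¬Sw e))) (label-conn s⇝c₀))
    h-injective : ∀ i j → h i ≡ h j → i ≡ j
    h-injective 0F        0F        _ = refl
    h-injective 0F        (F.suc b) e = ⊥-elim (s-apart b e)
    h-injective (F.suc a) 0F        e = ⊥-elim (s-apart a (sym e))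
    h-injective (F.suc a) (F.suc b) e with representative a | representative b
    ... | wa , ¬Swa , la≡ , _ | wb , ¬Swb , lb≡ , _ =
      cong F.suc (trans (sym la≡) (trans (label-conn (outside-conn ¬Swa ¬Swb e)) lb≡))
    k<k′ : k < k′
    k<k′ with k′ ℕ.<? suc k
    ... | no k′≮1+k = ≮⇒≥ k′≮1+k
    ... | yes k′<1+k with FinP.pigeonhole k′<1+k h
    ...   | i , j , i<j , hi≡hj = ⊥-elim (<-irrefl (cong toℕ (h-injective i j hi≡hj)) i<j)

  module _ {x y : V G} (P : Path G x y) where
    open Path P using (len; vert; start; end)

    segment-by : (Q : V G → Set) → ∀ d (i j : Fin (suc len)) → toℕ j ≡ d + toℕ i →
                 (∀ k → toℕ i < toℕ k → toℕ k ≤ toℕ j → Q (vert k)) → Conn G Q (vert i) (vert j)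
    segment-by Q zero    i j j≡i     inQ = subst (Conn G Q (vert i) ∘ vert) (FinP.toℕ-injective (sym j≡i)) here
    segment-by Q (suc d) i j j≡d+1+i inQ =
      step (inQ i′ i<i′ i′≤j) (Path.step P i i′ i′≡1+i)
           (segment-by Q d i′ j j≡d+i′ (λ k i′<k k≤j → inQ k (<-trans i<i′ i′<k) k≤j))
      where
      1+i≤j : suc (toℕ i) ≤ toℕ j
      1+i≤j = ≤-trans (s≤s (m≤n+m _ d)) (≤-reflexive (sym j≡d+1+i))
      i′ : Fin (suc len)
      i′ = fromℕ< (≤-<-trans 1+i≤j (FinP.toℕ<n j))
      i′≡1+i : toℕ i′ ≡ suc (toℕ i)
      i′≡1+i = FinP.toℕ-fromℕ< (≤-<-trans 1+i≤j (FinP.toℕ<n j))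
      i<i′ : toℕ i < toℕ i′
      i<i′ = ≤-reflexive (sym i′≡1+i)
      i′≤j : toℕ i′ ≤ toℕ j
      i′≤j = ≤-trans (≤-reflexive i′≡1+i) 1+i≤j
      j≡d+i′ : toℕ j ≡ d + toℕ i′
      j≡d+i′ = trans j≡d+1+i (sym (trans (cong (d +_) i′≡1+i) (+-suc d _)))

    segment : (Q : V G → Set) → ∀ (i j : Fin (suc len)) → toℕ i ≤ toℕ j →
              (∀ k → toℕ i < toℕ k → toℕ k ≤ toℕ j → Q (vert k)) → Conn G Q (vert i) (vert j)
    segment Q i j i≤j = segment-by Q (toℕ j ∸ toℕ i) i j (sym (m∸n+n≡m i≤j))

    internal : ∀ {w} i → vert i ≡ w → w ≢ x → w ≢ y → Internal G P w
    internal i refl w≢x w≢y =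
      i , n≢0⇒n>0 (λ i≡0 → w≢x (trans (cong vert (FinP.toℕ-injective {i = i} {j = 0F} i≡0)) start))
        , ≤∧≢⇒< (≤-pred (FinP.toℕ<n i))
                (λ i≡len → w≢y (trans (cong vert (FinP.toℕ-injective (trans i≡len (sym (FinP.toℕ-fromℕ len)))))
                                      end))
        , refl

    internal-from-start : ∀ {w} → Internal G P w →
                          ∃ λ p₁ → Internal G P p₁ × x ~ p₁ × Conn G (Internal G P) p₁ w
    internal-from-start (i , 0<i , i<len , refl) =
      vert one , (one , s≤s z≤n , subst (_< len) (sym one≡1) (≤-<-trans 0<i i<len) , refl)
      , subst (_~ vert one) start (Path.step P 0F one one≡1)
      , segment (Internal G P) one i (≤-trans (≤-reflexive one≡1) 0<i)
          (λ k 1<k k≤i → k , ≤-trans (s≤s z≤n) 1<k , ≤-<-trans k≤i i<len , refl)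
      where
      one : Fin (suc len)
      one = fromℕ< (s≤s (≤-trans 0<i (<⇒≤ i<len)))
      one≡1 : toℕ one ≡ 1
      one≡1 = FinP.toℕ-fromℕ< (s≤s (≤-trans 0<i (<⇒≤ i<len)))

    internal-to-end : ∀ {w} → Internal G P w →
                      ∃ λ pₗ → Internal G P pₗ × Conn G (Internal G P) w pₗ × pₗ ~ y
    internal-to-end (i , 0<i , i<len , refl) =
      vert lst , (lst , ≤-trans 0<i i≤lst , lst<len , refl)
      , segment (Internal G P) i lst i≤lst
          (λ k i<k k≤lst → k , ≤-<-trans z≤n i<k , ≤-<-trans k≤lst lst<len , refl)
      , subst (vert lst ~_) end (Path.step P lst (fromℕ len) (trans (FinP.toℕ-fromℕ len) (sym 1+lst≡len)))
      where
      1+pred : suc (len ∸ 1) ≡ len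
      1+pred = m+[n∸m]≡n (≤-trans 0<i (<⇒≤ i<len))
      lst : Fin (suc len)
      lst = fromℕ< (s≤s (m∸n≤m len 1))
      1+lst≡len : suc (toℕ lst) ≡ len
      1+lst≡len = trans (cong suc (FinP.toℕ-fromℕ< _)) 1+pred
      lst<len : toℕ lst < len
      lst<len = ≤-reflexive 1+lst≡len
      i≤lst : toℕ i ≤ toℕ lst
      i≤lst = ≤-pred (≤-trans i<len (≤-reflexive (sym 1+lst≡len)))

  module _ {m} (f : Fin m → V G) (f-next : ∀ i → f i ~ f (next i)) (Q : V G → Set) where

    interval-down : ∀ d i lo → toℕ i ≡ d + toℕ lo →
                    (∀ k → toℕ lo ≤ toℕ k → toℕ k ≤ toℕ i → Q (f k)) → Conn G Q (f i) (f lo)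
    interval-down zero    i lo i≡lo     _   = subst (Conn G Q (f i) ∘ f) (FinP.toℕ-injective i≡lo) here
    interval-down (suc d) i lo i≡1+d+lo inQ =
      step (inQ i′ (≤-trans (m≤n+m _ d) (≤-reflexive (sym i′≡d+lo))) i′≤i) fi~fi′
           (interval-down d i′ lo i′≡d+lo (λ k lo≤k k≤i′ → inQ k lo≤k (≤-trans k≤i′ i′≤i)))
      where
      1+d+lo<m : suc (d + toℕ lo) < m
      1+d+lo<m = subst (_< m) i≡1+d+lo (FinP.toℕ<n i)
      i′ : Fin m
      i′ = fromℕ< (<-trans (n<1+n _) 1+d+lo<m)
      i′≡d+lo : toℕ i′ ≡ d + toℕ lo
      i′≡d+lo = FinP.toℕ-fromℕ< _
      i′≤i : toℕ i′ ≤ toℕ i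
      i′≤i = ≤-trans (≤-reflexive i′≡d+lo) (≤-trans (n≤1+n _) (≤-reflexive (sym i≡1+d+lo)))
      next-i′ : next i′ ≡ i
      next-i′ = FinP.toℕ-injective
        (trans (next-toℕ i′ (subst (λ n → suc n < m) (sym i′≡d+lo) 1+d+lo<m))
               (trans (cong suc i′≡d+lo) (sym i≡1+d+lo)))
      fi~fi′ : f i ~ f i′
      fi~fi′ = ~-sym (subst (λ z → f i′ ~ f z) next-i′ (f-next i′))

    interval : ∀ lo hi → (∀ k → lo ≤ toℕ k → toℕ k < hi → Q (f k)) →
               ∀ {j k} → lo ≤ toℕ j → toℕ j < hi → lo ≤ toℕ k → toℕ k < hi → Conn G Q (f j) (f k)
    interval lo hi inQ {j} {k} lo≤j j<hi lo≤k k<hi =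
      Conn-trans (down j lo≤j j<hi) (Conn-sym (inQ k lo≤k k<hi) (down k lo≤k k<hi))
      where
      lo′ : Fin m
      lo′ = fromℕ< (≤-<-trans lo≤j (FinP.toℕ<n j))
      lo′≡lo : toℕ lo′ ≡ lo
      lo′≡lo = FinP.toℕ-fromℕ< _
      down : ∀ i → lo ≤ toℕ i → toℕ i < hi → Conn G Q (f i) (f lo′)
      down i lo≤i i<hi = interval-down (toℕ i ∸ lo) i lo′
        (trans (sym (m∸n+n≡m lo≤i)) (cong (toℕ i ∸ lo +_) (sym lo′≡lo)))
        (λ k lo′≤k k≤i → inQ k (subst (_≤ toℕ k) lo′≡lo lo′≤k) (≤-<-trans k≤i i<hi))

  -- Removing t and next t leaves the positions [1, m) if t is the last one, and otherwise
  -- [0, t) and [t + 2, m], joined through the edge from position m back to 0.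
  arc-connected : ∀ {m} (f : Fin m → V G) → (∀ i → f i ~ f (next i)) → (Q : V G → Set) → ∀ t →
                  (∀ i → i ≢ t → i ≢ next t → Q (f i)) →
                  ∀ {j k} → j ≢ t → j ≢ next t → k ≢ t → k ≢ next t → Conn G Q (f j) (f k)
  arc-connected {suc m} f f-next Q t inQ {j} {k} j≢t j≢t′ k≢t k≢t′ with next-SuccMod t
  ... | inj₂ (t≡m , t′≡0) =
    interval f f-next Q 1 m inQ′ (above j j≢t′) (below j j≢t) (above k k≢t′) (below k k≢t)
    where
    above : ∀ i → i ≢ next t → 1 ≤ toℕ i
    above i i≢t′ = n≢0⇒n>0 (λ i≡0 → i≢t′ (FinP.toℕ-injective (trans i≡0 (sym t′≡0))))
    below : ∀ i → i ≢ t → toℕ i < m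
    below i i≢t =
      ≤∧≢⇒< (≤-pred (FinP.toℕ<n i)) (λ i≡m → i≢t (FinP.toℕ-injective (trans i≡m (sym t≡m))))
    inQ′ : ∀ i → 1 ≤ toℕ i → toℕ i < m → Q (f i)
    inQ′ i 1≤i i<m = inQ i (λ { refl → <-irrefl t≡m i<m })
                           (λ i≡t′ → <-irrefl (sym (trans (cong toℕ i≡t′) t′≡0)) 1≤i)
  ... | inj₁ t′≡1+t = connect (classify j j≢t j≢t′) (classify k k≢t k≢t′)
    where
    Low High : Fin (suc m) → Set
    Low i = toℕ i < toℕ t
    High i = suc (suc (toℕ t)) ≤ toℕ i
    classify : ∀ i → i ≢ t → i ≢ next t → Low i ⊎ High i
    classify i i≢t i≢t′ with <-cmp (toℕ i) (toℕ t)
    ... | tri< i<t _ _ = inj₁ i<t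
    ... | tri≈ _ i≡t _ = ⊥-elim (i≢t (FinP.toℕ-injective i≡t))
    ... | tri> _ _ t<i =
      inj₂ (≤∧≢⇒< t<i (λ 1+t≡i → i≢t′ (FinP.toℕ-injective (trans (sym 1+t≡i) (sym t′≡1+t)))))
    inLow : ∀ i → 0 ≤ toℕ i → toℕ i < toℕ t → Q (f i)
    inLow i _ i<t = inQ i (λ { refl → <-irrefl refl i<t })
                          (λ i≡t′ → <-irrefl (trans (cong toℕ i≡t′) t′≡1+t) (<-trans i<t (n<1+n _)))
    inHigh : ∀ i → suc (suc (toℕ t)) ≤ toℕ i → toℕ i < suc m → Q (f i)
    inHigh i 2+t≤i _ =
      inQ i (λ { refl → 1+n≰n (≤-trans (n≤1+n _) 2+t≤i) })
            (λ i≡t′ → 1+n≰n (subst (suc (suc (toℕ t)) ≤_) (trans (cong toℕ i≡t′) t′≡1+t) 2+t≤i))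
    low : ∀ {i i′} → Low i → Low i′ → Conn G Q (f i) (f i′)
    low i<t i′<t = interval f f-next Q 0 (toℕ t) inLow z≤n i<t z≤n i′<t
    high : ∀ {i i′} → High i → High i′ → Conn G Q (f i) (f i′)
    high 2+t≤i 2+t≤i′ =
      interval f f-next Q (suc (suc (toℕ t))) (suc m) inHigh 2+t≤i (FinP.toℕ<n _) 2+t≤i′ (FinP.toℕ<n _)
    low-high : ∀ {i i′} → Low i → High i′ → Conn G Q (f i) (f i′)
    low-high {i} {i′} i<t 2+t≤i′ =
      Conn-trans (low {i} {0F} i<t (≤-<-trans z≤n i<t))
        (step (inHigh (fromℕ m) last-high (FinP.toℕ<n _)) f0~flast (high last-high 2+t≤i′))
      where
      last-high : High (fromℕ m)
      last-high =
        subst (suc (suc (toℕ t)) ≤_) (sym (FinP.toℕ-fromℕ m)) (≤-trans 2+t≤i′ (≤-pred (FinP.toℕ<n i′)))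
      f0~flast : f 0F ~ f (fromℕ m)
      f0~flast = ~-sym (subst (λ z → f (fromℕ m) ~ f z) (next-fromℕ m) (f-next (fromℕ m)))
    connect : Low j ⊎ High j → Low k ⊎ High k → Conn G Q (f j) (f k)
    connect (inj₁ lj) (inj₁ lk) = low lj lk
    connect (inj₂ hj) (inj₂ hk) = high hj hk
    connect (inj₁ lj) (inj₂ hk) = low-high lj hk
    connect (inj₂ hj) (inj₁ lk) = Conn-sym (inLow k z≤n lk) (low-high lk hj)

module HoleFacts {G : Graph} (C : Hole G) where
  open GraphFacts G

  L : ℕ
  L = Hole.len C

  c : Fin L → V G
  c = Hole.vert C

  c-injective : ∀ {i j} → c i ≡ c j → i ≡ j
  c-injective = Hole.inj C

  c-adjacent⇒consecutive : ∀ i j → c i ~ c j → j ≡ next i ⊎ i ≡ next j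
  c-adjacent⇒consecutive i j ij with Equivalence.to (Hole.chordless C i j) ij
  ... | inj₁ i→j = inj₁ (SuccMod⇒next i j i→j)
  ... | inj₂ j→i = inj₂ (SuccMod⇒next j i j→i)

  c-next : ∀ i → c i ~ c (next i)
  c-next i = Equivalence.from (Hole.chordless C i (next i)) (inj₁ (next-SuccMod i))

  c-prev : ∀ i → c (prev i) ~ c i
  c-prev i = subst (λ j → c (prev i) ~ c j) (next-prev i) (c-next (prev i))

  next≢ : ∀ (i : Fin L) → next i ≢ i
  next≢ i e = SuccMod-irreflexive {L} (≤-trans (s≤s (s≤s z≤n)) (Hole.len≥4 C))
                (subst (SuccMod L (toℕ i) ∘ toℕ) e (next-SuccMod i))

  next≢prev : ∀ (i : Fin L) → next i ≢ prev i
  next≢prev i e = SuccMod-asymmetric {L} (≤-trans (s≤s (s≤s (s≤s z≤n))) (Hole.len≥4 C)) (prev-SuccMod i)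
                    (subst (SuccMod L (toℕ i) ∘ toℕ) e (next-SuccMod i))

  next-next≢ : ∀ (i : Fin L) → next (next i) ≢ i
  next-next≢ i e = SuccMod-asymmetric {L} (≤-trans (s≤s (s≤s (s≤s z≤n))) (Hole.len≥4 C)) (next-SuccMod i)
                     (subst (SuccMod L (toℕ (next i)) ∘ toℕ) e (next-SuccMod (next i)))

  no-3-cycle : ∀ {a b d : Fin L} → b ≡ next a → d ≡ next b → a ≡ next d → ⊥
  no-3-cycle {a} {b} {d} refl refl a≡ =
    SuccMod-no-triangle {L} (Hole.len≥4 C) (next-SuccMod a) (next-SuccMod b)
      (subst (SuccMod L (toℕ d) ∘ toℕ) (sym a≡) (next-SuccMod d))

  no-triangle : ∀ i j k → c i ~ c j → c j ~ c k → c i ~ c k → ⊥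
  no-triangle i j k ij jk ik
    with c-adjacent⇒consecutive i j ij | c-adjacent⇒consecutive j k jk | c-adjacent⇒consecutive i k ik
  ... | inj₁ j≡ | inj₁ k≡ | inj₁ k≡′ = ~-irrefl jk (cong c (trans j≡ (sym k≡′)))
  ... | inj₁ j≡ | inj₁ k≡ | inj₂ i≡  = no-3-cycle j≡ k≡ i≡
  ... | inj₁ j≡ | inj₂ j≡′ | _       = ~-irrefl ik (cong c (next-injective (trans (sym j≡) j≡′)))
  ... | inj₂ i≡ | inj₁ k≡ | _        = ~-irrefl ik (cong c (trans i≡ (sym k≡)))
  ... | inj₂ i≡ | inj₂ j≡ | inj₁ k≡  = no-3-cycle i≡ k≡ j≡
  ... | inj₂ i≡ | inj₂ j≡ | inj₂ i≡′ = ~-irrefl jk (cong c (next-injective (trans (sym i≡) i≡′)))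

  triangle-free : ∀ {x y z} → InHole G C x → InHole G C y → InHole G C z → x ~ y → y ~ z → x ~ z → ⊥
  triangle-free (i , refl) (j , refl) (k , refl) = no-triangle i j k

  hole-neighbour : ∀ i j → c i ~ c j → j ≡ next i ⊎ j ≡ prev i
  hole-neighbour i j ij with c-adjacent⇒consecutive i j ij
  ... | inj₁ j≡ = inj₁ j≡
  ... | inj₂ i≡ = inj₂ (next-injective (trans (sym i≡) (sym (next-prev i))))

  edge-of-adjacent : ∀ {x y} → InHole G C x → InHole G C y → x ~ y → EdgeOfHole G C x y
  edge-of-adjacent (i , refl) (j , refl) ij = i , j , Equivalence.to (Hole.chordless C i j) ij , refl , refl

  inHole? : ∀ v → Dec (InHole G C v)
  inHole? v = FinP.any? (λ i → c i ≟ᵥ v)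

  X? : ∀ v → Dec (X G C v)
  X? v with FinP.all? (λ i → adj? v (c i))
  ... | yes v~all = yes (λ { _ (i , refl) → v~all i })
  ... | no  ¬v~all = no (λ v∈X → ¬v~all (λ i → v∈X (c i) (i , refl)))

  XCe? : ∀ u v w → Dec (XCe G C u v w)
  XCe? u v w = X? w ⊎-dec ((w ≟ᵥ u) ⊎-dec (w ≟ᵥ v))

  X∉C : ∀ {w} → X G C w → ¬ InHole G C w
  X∉C Xw w∈C = ~-irrefl (Xw _ w∈C) refl

  edge-ends-in-hole : ∀ {u v w} → EdgeOfHole G C u v → w ≡ u ⊎ w ≡ v → InHole G C w
  edge-ends-in-hole (iu , _ , _ , refl , _) (inj₁ refl) = iu , refl
  edge-ends-in-hole (_ , iv , _ , _ , refl) (inj₂ refl) = iv , refl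

  edge-adjacent : ∀ {u v} → EdgeOfHole G C u v → u ~ v
  edge-adjacent (i , j , ij , refl , refl) = Equivalence.from (Hole.chordless C i j) ij

  other-neighbour : ∀ {u v} → EdgeOfHole G C u v → ∃ λ c₀ → InHole G C c₀ × c₀ ~ u × c₀ ≢ u × c₀ ≢ v
  other-neighbour uv@(iu , iv , _ , refl , refl) with hole-neighbour iu iv (edge-adjacent uv)
  ... | inj₁ refl = c (prev iu) , (prev iu , refl) , c-prev iu
                  , (λ e → next≢ iu (trans (cong next (sym (c-injective e))) (next-prev iu)))
                  , (λ e → next≢prev iu (sym (c-injective e)))
  ... | inj₂ refl = c (next iu) , (next iu , refl) , ~-sym (c-next iu)
                  , (λ e → next≢ iu (c-injective e)) , (λ e → next≢prev iu (c-injective e))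

  InHoleWithout : V G → V G → V G → Set
  InHoleWithout x w a = InHole G C a × a ≢ x × a ≢ w

  InHoleWithout-swap : ∀ {x w a} → InHoleWithout x w a → InHoleWithout w x a
  InHoleWithout-swap (a∈C , a≢x , a≢w) = a∈C , a≢w , a≢x

  arc : ∀ t {a b} → InHoleWithout (c t) (c (next t)) a → InHoleWithout (c t) (c (next t)) b →
        Conn G (InHoleWithout (c t) (c (next t))) a b
  arc t ((ka , refl) , a≢ , a≢′) ((kb , refl) , b≢ , b≢′) =
    arc-connected c c-next _ t
      (λ k k≢t k≢t′ → (k , refl) , (λ e → k≢t (c-injective e)) , (λ e → k≢t′ (c-injective e)))
      (λ e → a≢ (cong c e)) (λ e → a≢′ (cong c e)) (λ e → b≢ (cong c e)) (λ e → b≢′ (cong c e))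

  InHoleWithout-connected : ∀ {x w a b} → InHole G C x → InHole G C w → x ~ w →
                            InHoleWithout x w a → InHoleWithout x w b → Conn G (InHoleWithout x w) a b
  InHoleWithout-connected (i , refl) (j , refl) ij oa ob with c-adjacent⇒consecutive i j ij
  ... | inj₁ refl = arc i oa ob
  ... | inj₂ refl = Conn-mono (λ _ → InHoleWithout-swap) (arc j (InHoleWithout-swap oa) (InHoleWithout-swap ob))

module Detours {G : Graph} (C : Hole G) (disjoint : HoleEdgeDisjoint G) where
  open GraphFacts G
  open HoleFacts C

  -- A shortest path from y to x through C − {x, w} and T, avoiding the edge xy, closes a hole
  -- through xy that misses w, contradicting edge-disjointness.
  no-detour : ∀ {x y w} → InHole G C x → InHole G C y → InHole G C w → x ~ y → x ~ w → y ≢ w →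
              (T : V G → Set) → (∀ v → T v → ¬ InHole G C v) → (∀ v → T v → v ~ x → v ~ y → ⊥) →
              ∀ {t₁ t₂ a} → T t₁ → Conn G T t₁ t₂ → t₁ ~ x → t₂ ~ a → InHoleWithout x w a → ⊥
  no-detour {x} {y} {w} x∈C y∈C w∈C x~y x~w y≢w T T∉C T≁xy {t₁} {t₂} Tt₁ t₁⇝t₂ t₁~x t₂~a a∉xw =
    closing-hole-misses-w (shortcut walk)
    where
    open Shortcut _≟ᵥ_ (adjWithout? x y)
    Region : V G → Set
    Region v = T v ⊎ (InHole G C v × v ≢ w)
    T≢x : ∀ {v} → T v → v ≢ x
    T≢x Tv refl = T∉C _ Tv x∈C
    lift : ∀ {P : V G → Set} → (∀ {v} → P v → Region v) → (∀ {v} → P v → v ≢ x) →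
           ∀ {p q} → P p → Conn G P p q → Walk Region p q
    lift P⊆Region P≢x Pp here             = stop
    lift P⊆Region P≢x Pp (step Pz p~z c) =
      move (p~z , (λ e → P≢x Pp (proj₁ e)) , (λ e → P≢x Pz (proj₂ e))) (P⊆Region Pz) (lift P⊆Region P≢x Pz c)
    y∉xw : InHoleWithout x w y
    y∉xw = y∈C , ≢-sym (~-irrefl x~y) , y≢w
    walk : Walk Region y x
    walk = lift (λ o → inj₂ (proj₁ o , proj₂ (proj₂ o))) (λ o → proj₁ (proj₂ o)) y∉xw
                (InHoleWithout-connected x∈C w∈C x~w y∉xw a∉xw)
        ++ʷ move (~-sym t₂~a , (λ e → proj₁ (proj₂ a∉xw) (proj₁ e)) , (λ e → T≢x Tt₂ (proj₂ e))) (inj₁ Tt₂)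
            (lift inj₁ T≢x Tt₂ (Conn-sym Tt₁ t₁⇝t₂)
        ++ʷ move (t₁~x , (λ e → T≢x Tt₁ (proj₁ e))
                       , (λ e → T∉C _ Tt₁ (subst (InHole G C) (sym (proj₁ e)) y∈C)))
                 (inj₂ (x∈C , ~-irrefl x~w)) stop)
      where
      Tt₂ : T t₂
      Tt₂ = Conn-target Tt₁ t₁⇝t₂
    length≥4 : ∀ l → Induced (y ∷ l) → last (y ∷ l) ≡ just x → All Region l → 4 ≤ length (y ∷ l)
    length≥4 []              _                    ends _ = ⊥-elim (~-irrefl x~y (sym (just-injective ends)))
    length≥4 (_ ∷ [])        ((_ , _ , ¬yx) , _) refl _ = ⊥-elim (¬yx (refl , refl))
    length≥4 (b ∷ _ ∷ [])    ((y~b , _) , _ , _ , (b~x , _) , _) refl (Sb ∷ _) with Sb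
    ... | inj₁ Tb       = ⊥-elim (T≁xy b Tb b~x (~-sym y~b))
    ... | inj₂ (b∈C , _) = ⊥-elim (triangle-free x∈C y∈C b∈C x~y y~b (~-sym b~x))
    length≥4 (_ ∷ _ ∷ _ ∷ _) _ _ _ = s≤s (s≤s (s≤s (s≤s z≤n)))
    closing-hole-misses-w : (Σ (List (V G)) λ l → Induced (y ∷ l) × last (y ∷ l) ≡ just x × All Region l) → ⊥
    closing-hole-misses-w (l , induced , ends , inS)
      with hole-from-induced-path x~y l induced ends (length≥4 l induced ends inS)
    ... | D , xy∈D , D≡l
      with Equivalence.to (D≡l w) (Equivalence.to (disjoint C D x y (edge-of-adjacent x∈C y∈C x~y) xy∈D w) w∈C)
    ... | Any.here w≡y = y≢w (sym w≡y)
    ... | Any.there w∈l with All.lookup inS w∈l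
    ...   | inj₁ Tw          = T∉C w Tw w∈C
    ...   | inj₂ (_ , w≢w) = w≢w refl

  Outside : V G → Set
  Outside v = ¬ InCX G C v

  outside-vertex-cannot-join : ∀ {z p q} → Outside z → z ~ p → z ~ q →
                               InHole G C p → InHole G C q → p ≢ q → ¬ p ~ q → ⊥
  outside-vertex-cannot-join {z} {p} {q} z∉ z~p z~q (ip , refl) q∈C p≢q p≁q
    with FinP.any? (λ i → adj? z (c i) ×-dec ¬? (adj? z (c (next i))))
  ... | no ¬leaves = z∉ (inj₂ (λ { _ (j , refl) → next-closed (λ i → z ~ c i) z~next ip z~p j }))
    where
    z~next : ∀ i → z ~ c i → z ~ c (next i)
    z~next i z~ci with adj? z (c (next i))
    ... | yes z~ci′ = z~ci′
    ... | no  z≁ci′ = ⊥-elim (¬leaves (i , z~ci , z≁ci′))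
  ... | yes (i , z~ci , z≁ci′) = detour-to (pick (p ≟ᵥ c i) (p ≟ᵥ c (prev i)))
    where
    detour-to : ∃ (λ a → z ~ a × InHoleWithout (c i) (c (prev i)) a) → ⊥
    detour-to (a , z~a , a∉) =
      no-detour (i , refl) (next i , refl) (prev i , refl) (c-next i) (~-sym (c-prev i))
        (λ e → next≢prev i (c-injective e))
        (_≡ z) (λ { _ refl → z∉ ∘ inj₁ }) (λ { _ refl _ z~ci′ → z≁ci′ z~ci′ }) refl here z~ci z~a a∉
    pick : Dec (p ≡ c i) → Dec (p ≡ c (prev i)) → ∃ λ a → z ~ a × InHoleWithout (c i) (c (prev i)) a
    pick (no p≢ci) (no p≢ci′) = p , z~p , (ip , refl) , p≢ci , p≢ci′
    pick (yes p≡ci) _ = q , z~q , q∈C , (λ q≡ → p≢q (trans p≡ci (sym q≡)))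
                                      , (λ q≡ → p≁q (subst₂ _~_ (sym p≡ci) (sym q≡) (~-sym (c-prev i))))
    pick (no _) (yes p≡ci′) = q , z~q , q∈C , (λ q≡ → p≁q (subst₂ _~_ (sym p≡ci′) (sym q≡) (c-prev i)))
                                            , (λ q≡ → p≢q (trans p≡ci′ (sym q≡)))

  LastTouch : (V G → Set) → V G → V G → Set
  LastTouch P a y = ∃ λ z → P z × z ~ a × Conn G (λ v → P v × ¬ v ~ a) z y

  avoid-or-last-touch : ∀ {P} a {x y} → P x → Conn G P x y →
                        (¬ x ~ a × Conn G (λ v → P v × ¬ v ~ a) x y) ⊎ LastTouch P a y
  avoid-or-last-touch a {x} px here with adj? x a
  ... | yes x~a = inj₂ (x , px , x~a , here)
  ... | no  x≁a = inj₁ (x≁a , here)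
  avoid-or-last-touch a {x} px (step pz x~z c) with avoid-or-last-touch a pz c
  ... | inj₂ touch       = inj₂ touch
  ... | inj₁ (z≁a , avoid) with adj? x a
  ...   | yes x~a = inj₂ (x , px , x~a , step (pz , z≁a) x~z avoid)
  ...   | no  x≁a = inj₁ (x≁a , step (pz , z≁a) x~z avoid)

  last-touch-cannot-reach : ∀ {x y w z zₘ b} → InHole G C x → InHole G C y → InHole G C w →
                            x ~ y → x ~ w → y ≢ w → Outside z → z ~ x → ¬ z ~ y →
                            Conn G (λ v → Outside v × ¬ v ~ x) z zₘ → zₘ ~ b → InHoleWithout x w b → ⊥
  last-touch-cannot-reach {x} {y} {z = z} x∈C y∈C w∈C x~y x~w y≢w z∉ z~x z≁y avoid zₘ~b b∉ =
    no-detour x∈C y∈C w∈C x~y x~w y≢w Suffix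
      (λ { _ (inj₁ (v∉ , _)) → v∉ ∘ inj₁ ; _ (inj₂ refl) → z∉ ∘ inj₁ })
      (λ { _ (inj₁ (_ , v≁x)) v~x _ → v≁x v~x ; _ (inj₂ refl) _ z~y → z≁y z~y })
      (inj₂ refl) (Conn-mono (λ _ → inj₁) avoid) z~x zₘ~b b∉
    where
    Suffix : V G → Set
    Suffix v = (Outside v × ¬ v ~ x) ⊎ v ≡ z

  outside-path-cannot-join : ∀ {a b z₁ zₘ} → InHole G C a → InHole G C b → a ≢ b → ¬ a ~ b →
                             Outside z₁ → Conn G Outside z₁ zₘ → z₁ ~ a → zₘ ~ b → ⊥
  outside-path-cannot-join {a} {b} (ia , refl) b∈C a≢b a≁b z₁∉ z₁⇝zₘ z₁~a zₘ~b
    with avoid-or-last-touch a z₁∉ z₁⇝zₘ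
  ... | inj₁ (z₁≁a , _) = z₁≁a z₁~a
  ... | inj₂ (z , z∉ , z~a , avoid) with adj? z (c (next ia)) | adj? z (c (prev ia))
  ...   | yes z~a′ | yes z~a″ =
    outside-vertex-cannot-join z∉ z~a′ z~a″ (next ia , refl) (prev ia , refl) (λ e → next≢prev ia (c-injective e))
      (λ a′~a″ → no-triangle ia (next ia) (prev ia) (c-next ia) a′~a″ (~-sym (c-prev ia)))
  ...   | no z≁a′ | _ =
    last-touch-cannot-reach (ia , refl) (next ia , refl) (prev ia , refl) (c-next ia) (~-sym (c-prev ia))
      (λ e → next≢prev ia (c-injective e)) z∉ z~a z≁a′ avoid zₘ~b
      (b∈C , ≢-sym a≢b , λ b≡ → a≁b (subst (c ia ~_) (sym b≡) (~-sym (c-prev ia))))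
  ...   | yes _ | no z≁a″ =
    last-touch-cannot-reach (ia , refl) (prev ia , refl) (next ia , refl) (~-sym (c-prev ia)) (c-next ia)
      (λ e → next≢prev ia (c-injective (sym e))) z∉ z~a z≁a″ avoid zₘ~b
      (b∈C , ≢-sym a≢b , λ b≡ → a≁b (subst (c ia ~_) (sym b≡) (c-next ia)))

  ¬XCe⇒Outside : ∀ {u v z} → ¬ InHole G C z → ¬ XCe G C u v z → Outside z
  ¬XCe⇒Outside z∉C z∉S = [ z∉C , (λ Xz → z∉S (inj₁ Xz)) ]′

  first-hole-vertex : ∀ {u v x y} → Outside x → Conn G (λ w → ¬ XCe G C u v w) x y → InHole G C y →
                      ∃ λ t → Conn G Outside x t × ∃ λ c′ → InHole G C c′ × ¬ XCe G C u v c′ × t ~ c′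
  first-hole-vertex x∉ here y∈C = ⊥-elim (x∉ (inj₁ y∈C))
  first-hole-vertex {x = x} x∉ (step {z = z} z∉S x~z z⇝y) y∈C with inHole? z
  ... | yes z∈C = x , here , z , z∈C , z∉S , x~z
  ... | no  z∉C with first-hole-vertex (¬XCe⇒Outside z∉C z∉S) z⇝y y∈C
  ...   | t , z⇝t , rest = t , step (¬XCe⇒Outside z∉C z∉S) x~z z⇝t , rest

  SCe⇒outside-walks : ∀ {u v s} → SCe G C u v s →
    Outside s × (∃ λ p₁ → Outside p₁ × u ~ p₁ × Conn G Outside p₁ s)
              × (∃ λ pₗ → Outside pₗ × Conn G Outside s pₗ × pₗ ~ v)
  SCe⇒outside-walks (P , (avoid , _) , (i , vi≡s) , s≢u , s≢v)
    with internal P i vi≡s s≢u s≢v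
  ... | s-int with internal-from-start P s-int | internal-to-end P s-int
  ...   | p₁ , p₁-int , u~p₁ , p₁⇝s | pₗ , pₗ-int , s⇝pₗ , pₗ~v =
    avoid _ s-int , (p₁ , avoid _ p₁-int , u~p₁ , Conn-mono avoid p₁⇝s)
                  , (pₗ , avoid _ pₗ-int , Conn-mono avoid s⇝pₗ , pₗ~v)

  SCe-cut-from-hole : ∀ {u v s c′} → EdgeOfHole G C u v → SCe G C u v s → InHole G C c′ →
                      ¬ Conn G (λ w → ¬ XCe G C u v w) s c′
  SCe-cut-from-hole uv@(iu , iv , _ , refl , refl) s∈S c′∈C s⇝c′ with SCe⇒outside-walks s∈S
  ... | s∉ , (p₁ , p₁∉ , u~p₁ , p₁⇝s) , (pₗ , pₗ∉ , s⇝pₗ , pₗ~v)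
    with first-hole-vertex s∉ s⇝c′ c′∈C
  ... | t , s⇝t , c″ , c″∈C , c″∉S , t~c″ with adj? (c iu) c″
  ...   | yes u~c″ = outside-path-cannot-join (iv , refl) c″∈C (λ e → c″∉S (inj₂ (inj₂ (sym e))))
                       (λ v~c″ → triangle-free (iu , refl) (iv , refl) c″∈C (edge-adjacent uv) v~c″ u~c″)
                       pₗ∉ (Conn-trans (Conn-sym s∉ s⇝pₗ) s⇝t) pₗ~v t~c″
  ...   | no  u≁c″ = outside-path-cannot-join (iu , refl) c″∈C (λ e → c″∉S (inj₂ (inj₁ (sym e)))) u≁c″
                       p₁∉ (Conn-trans p₁⇝s s⇝t) (~-sym u~p₁) t~c″

  SCe⇒more-components : ∀ {u v s k k′} → EdgeOfHole G C u v → SCe G C u v s →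
    HasComponents G (Whole G) k → HasComponents G (λ w → ¬ XCe G C u v w) k′ → k < k′
  SCe⇒more-components {u} {v} {s} uv s∈S@(_ , _ , _ , s≢u , s≢v) comps comps′
    with other-neighbour uv | SCe⇒outside-walks s∈S
  ... | c₀ , c₀∈C , c₀~u , c₀≢u , c₀≢v | s∉ , (p₁ , _ , u~p₁ , p₁⇝s) , _ =
    more-components comps comps′ c₀∉S S⇝c₀ s∉S s⇝c₀ (SCe-cut-from-hole uv s∈S c₀∈C)
    where
    c₀∉S : ¬ XCe G C u v c₀
    c₀∉S = [ (λ Xc₀ → X∉C Xc₀ c₀∈C) , [ c₀≢u , c₀≢v ]′ ]′
    s∉S : ¬ XCe G C u v s
    s∉S = [ (λ Xs → s∉ (inj₂ Xs)) , [ s≢u , s≢v ]′ ]′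
    S⇝c₀ : ∀ w → XCe G C u v w → Conn G (Whole G) w c₀
    S⇝c₀ w (inj₁ Xw)          = step tt (Xw c₀ c₀∈C) here
    S⇝c₀ w (inj₂ (inj₁ refl)) = step tt (~-sym c₀~u) here
    S⇝c₀ w (inj₂ (inj₂ refl)) = step tt (~-sym (edge-adjacent uv)) (step tt (~-sym c₀~u) here)
    s⇝c₀ : Conn G (Whole G) s c₀
    s⇝c₀ = Conn-snoc (Conn-snoc (Conn-sym tt (Conn-mono (λ _ _ → tt) p₁⇝s)) tt (~-sym u~p₁)) tt (~-sym c₀~u)

module Clique {G : Graph} (K222-free : K222Free G) (disjoint : HoleEdgeDisjoint G) (C : Hole G) where
  open GraphFacts G
  open HoleFacts C

  i₀ : Fin L
  i₀ = fromℕ< (≤-trans (s≤s z≤n) (Hole.len≥4 C))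

  c₀ c₁ c₂ c₃ : V G
  c₀ = c i₀
  c₁ = c (next i₀)
  c₂ = c (next (next i₀))
  c₃ = c (next (next (next i₀)))

  c₀≢c₂ : c₀ ≢ c₂
  c₀≢c₂ e = next-next≢ i₀ (c-injective (sym e))

  c₀≢c₃ : c₀ ≢ c₃
  c₀≢c₃ e = no-3-cycle refl refl (c-injective e)

  c₂≢c₃ : c₂ ≢ c₃
  c₂≢c₃ e = next≢ _ (c-injective (sym e))

  c₀≁c₂ : ¬ c₀ ~ c₂
  c₀≁c₂ = no-triangle _ _ _ (c-next _) (c-next _)

  c₁≁c₃ : ¬ c₁ ~ c₃
  c₁≁c₃ = no-triangle _ _ _ (c-next _) (c-next _)

  module _ {x y} (Xx : X G C x) (Xy : X G C y) (x≢y : x ≢ y) (x≁y : ¬ x ~ y) where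

    x~ : ∀ i → x ~ c i
    x~ i = Xx (c i) (i , refl)

    y~ : ∀ i → y ~ c i
    y~ i = Xy (c i) (i , refl)

    short-hole : c₃ ~ c₀ → ⊥
    short-hole c₃~c₀ = K222-free _ (K222-induced v distinct nonadjacent v01 v02 v12)
      where
      v : Fin 3 → Fin 2 → V G
      v 0F 0F = x
      v 0F 1F = y
      v 1F 0F = c₀
      v 1F 1F = c₂
      v 2F 0F = c₁
      v 2F 1F = c₃
      distinct : ∀ p → v p 0F ≢ v p 1F
      distinct 0F = x≢y
      distinct 1F = c₀≢c₂
      distinct 2F = λ e → next-next≢ _ (c-injective (sym e))
      nonadjacent : ∀ p → ¬ v p 0F ~ v p 1F
      nonadjacent 0F = x≁y
      nonadjacent 1F = c₀≁c₂
      nonadjacent 2F = c₁≁c₃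
      X-pair : ∀ s i → v 0F s ~ c i
      X-pair 0F = x~
      X-pair 1F = y~
      v01 : ∀ s t → v 0F s ~ v 1F t
      v01 s 0F = X-pair s _
      v01 s 1F = X-pair s _
      v02 : ∀ s t → v 0F s ~ v 2F t
      v02 s 0F = X-pair s _
      v02 s 1F = X-pair s _
      v12 : ∀ s t → v 1F s ~ v 2F t
      v12 0F 0F = c-next _
      v12 0F 1F = ~-sym c₃~c₀
      v12 1F 0F = ~-sym (c-next _)
      v12 1F 1F = c-next _

    long-hole : ¬ c₃ ~ c₀ → ⊥
    long-hole c₃≁c₀
      with square-hole (x~ i₀) (~-sym (y~ i₀)) (y~ _) (~-sym (x~ _)) x≁y c₀≁c₂ x≢y c₀≢c₂
         | square-hole (x~ i₀) (~-sym (y~ i₀)) (y~ _) (~-sym (x~ _)) x≁y (c₃≁c₀ ∘ ~-sym) x≢y c₀≢c₃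
    ... | D₁ , xc₀∈D₁ , D₁≡ | D₂ , xc₀∈D₂ , D₂≡
      with Equivalence.to (D₂≡ c₂)
             (Equivalence.to (disjoint D₁ D₂ x c₀ xc₀∈D₁ xc₀∈D₂ c₂)
               (Equivalence.from (D₁≡ c₂) (Any.there (Any.there (Any.here refl)))))
    ... | Any.here c₂≡c₀                               = c₀≢c₂ (sym c₂≡c₀)
    ... | Any.there (Any.here c₂≡y)                    = ~-irrefl (y~ _) (sym c₂≡y)
    ... | Any.there (Any.there (Any.here c₂≡c₃))       = c₂≢c₃ c₂≡c₃
    ... | Any.there (Any.there (Any.there (Any.here c₂≡x))) = ~-irrefl (x~ _) (sym c₂≡x)

  X-clique : ∀ x y → X G C x → X G C y → x ≢ y → x ~ y
  X-clique x y Xx Xy x≢y with adj? x y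
  ... | yes x~y = x~y
  ... | no  x≁y with adj? c₃ c₀
  ...   | yes c₃~c₀ = ⊥-elim (short-hole Xx Xy x≢y x≁y c₃~c₀)
  ...   | no  c₃≁c₀ = ⊥-elim (long-hole Xx Xy x≢y x≁y c₃≁c₀)

  XCe-complete : ∀ {u v} → EdgeOfHole G C u v → ∀ x y → XCe G C u v x → XCe G C u v y → x ≢ y → x ~ y
  XCe-complete uv x y (inj₁ Xx)          (inj₁ Xy)          x≢y = X-clique x y Xx Xy x≢y
  XCe-complete uv x y (inj₁ Xx)          (inj₂ y∈uv)        _   = Xx y (edge-ends-in-hole uv y∈uv)
  XCe-complete uv x y (inj₂ x∈uv)        (inj₁ Xy)          _   = ~-sym (Xy x (edge-ends-in-hole uv x∈uv))
  XCe-complete uv x y (inj₂ (inj₁ refl)) (inj₂ (inj₁ refl)) x≢y = ⊥-elim (x≢y refl)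
  XCe-complete uv x y (inj₂ (inj₁ refl)) (inj₂ (inj₂ refl)) _   = edge-adjacent uv
  XCe-complete uv x y (inj₂ (inj₂ refl)) (inj₂ (inj₁ refl)) _   = ~-sym (edge-adjacent uv)
  XCe-complete uv x y (inj₂ (inj₂ refl)) (inj₂ (inj₂ refl)) x≢y = ⊥-elim (x≢y refl)

proposition1p7 : (G : Graph) → K222Free G → HoleEdgeDisjoint G →
    (C : Hole G) (u v : V G) → EdgeOfHole G C u v →
    (∃ λ w → SCe G C u v w) →
    CliqueCut G (XCe G C u v)
proposition1p7 G K222-free disjoint C u v uv (s , s∈S) = XCe-complete uv , more-components-after-cut
  where
  open GraphFacts G
  open HoleFacts C
  open Detours C disjoint
  open Clique K222-free disjoint C using (XCe-complete)
  more-components-after-cut : ∃ λ k → ∃ λ k′ →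
    HasComponents G (Whole G) k × HasComponents G (λ w → ¬ XCe G C u v w) k′ × k < k′
  more-components-after-cut with components {Whole G} (λ _ → yes tt) | components (λ w → ¬? (XCe? u v w))
  ... | k , comps | k′ , comps′ = k , k′ , comps , comps′ , SCe⇒more-components uv s∈S comps comps′
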